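{- Let $\mathbb{F}_\omega$ be the free group with basis $e_1,e_2,\ldots$. Fix $n\in\mathbb{N}$ and for $i,j,k,l\in\{1,\ldots,n\}$ set $a_{ij}:=e_{i+j}^5e_i$ and $b_{kl}:=e_k^{ -1}e_{k+l}^{ -4}$. Let $$\varphi_{NE}(x,y):=\forall u\,\forall v\,\big([u,v]\ne 1\rightarrow xy\ne u^5v^4\big).$$ If $i=k$ and $j\ne l$, then $\mathbb{F}_\omega\models\neg\varphi_{NE}(a_{ij},b_{kl})$.
   Context: $[u,v]=u^{ -1}v^{ -1}uv$ denotes the commutator. -}

module Defs where

open import Data.Nat using (ℕ; zero; suc; _+_; _∸_; _≡ᵇ_)
open import Data.Bool using (Bool; true; false; not; _∧_; _xor_; if_then_else_)
open import Data.Product using (_×_; _,_)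
open import Data.List using (List; []; _∷_; _++_; foldr; reverse; map)
open import Relation.Binary.PropositionalEquality using (_≡_)
open import Relation.Nullary using (¬_)

-- The free group F_ω with basis e_1, e_2, ...
-- A letter (m , true) stands for e_{m+1}, (m , false) for e_{m+1}^{-1}.
Letter : Set
Letter = ℕ × Bool

-- Elements of F_ω are represented by words; two words are equal in F_ω
-- iff their free reductions (reduced normal forms) coincide.
FG : Set
FG = List Letter

push : Letter → List Letter → List Letter
push x [] = x ∷ []
push (m , s) ((m' , s') ∷ w) =
  if (m ≡ᵇ m') ∧ (s xor s')
  then w
  else (m , s) ∷ (m' , s') ∷ w

reduce : FG → List Letter
reduce = foldr push []

infix 4 _≈_
_≈_ : FG → FG → Set
x ≈ y = reduce x ≡ reduce y

ε : FG
ε = []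

infixl 7 _·_
_·_ : FG → FG → FG
x · y = x ++ y

flipL : Letter → Letter
flipL (m , s) = (m , not s)

_⁻¹ : FG → FG
x ⁻¹ = reverse (map flipL x)

infixr 8 _^_
_^_ : FG → ℕ → FG
x ^ zero = ε
x ^ suc k = x · (x ^ k)

[_,_] : FG → FG → FG
[ u , v ] = (u ⁻¹) · (v ⁻¹) · u · v

-- basis element e_i (i ≥ 1); e_i is the letter with index i ∸ 1
e : ℕ → FG
e i = (i ∸ 1 , true) ∷ []

a : ℕ → ℕ → FG
a i j = (e (i + j) ^ 5) · e i

b : ℕ → ℕ → FG
b k l = (e k ⁻¹) · ((e (k + l) ⁻¹) ^ 4)

φNE : FG → FG → Set
φNE x y = ∀ (u v : FG) → ¬ ([ u , v ] ≈ ε) → ¬ (x · y ≈ (u ^ 5) · (v ^ 4))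

module Submission where

-- With i = k the product a_{ij} b_{il} is the word
--   e_{i+j}^5 · e_i · e_i^{-1} · e_{i+l}^{-4},
-- which equals u^5 v^4 for u = e_{i+j} and v = e_{i+l}^{-1} once the middle
-- pair e_i e_i^{-1} is cancelled; and [u,v] ≠ 1 because i+j ≠ i+l, so u and v
-- are (inverses of) distinct basis elements, which do not commute.

open import Defs
open import Data.Nat using (ℕ; suc; _≤_; _+_; _≡ᵇ_)
open import Data.Nat.Properties using (≡ᵇ⇒≡; ≡⇒≡ᵇ; +-cancelˡ-≡)
open import Data.Bool using (Bool; true; false; not; _∧_; _xor_; T)
open import Data.Product using (_,_)
open import Data.List using (List; []; _∷_; _++_; foldr)
open import Data.List.Properties using (foldr-++)
open import Data.List.Relation.Unary.Linked using (Linked; []; [-]; _∷_; tail)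
open import Relation.Binary.PropositionalEquality
  using (_≡_; _≢_; refl; sym; trans; cong; subst; module ≡-Reasoning)
open import Relation.Nullary using (¬_)
open import Data.Empty using (⊥-elim)

Cancels : Letter → Letter → Bool
Cancels (m , s) (m' , s') = (m ≡ᵇ m') ∧ (s xor s')

NoCancel : Letter → Letter → Set
NoCancel x y = Cancels x y ≡ false

Reduced : List Letter → Set
Reduced = Linked NoCancel

gen : Letter → FG
gen x = x ∷ []

≡ᵇ-refl : (m : ℕ) → (m ≡ᵇ m) ≡ true
≡ᵇ-refl m with m ≡ᵇ m in eq
... | true  = refl
... | false = ⊥-elim (subst T eq (≡⇒≡ᵇ m m refl))

≡ᵇ-distinct : {m m' : ℕ} → m ≢ m' → (m ≡ᵇ m') ≡ false
≡ᵇ-distinct {m} {m'} m≢m' with m ≡ᵇ m' in eq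
... | false = refl
... | true  = ⊥-elim (m≢m' (≡ᵇ⇒≡ m m' (subst T (sym eq) _)))

cancels-flip : (x : Letter) → Cancels x (flipL x) ≡ true
cancels-flip (m , true)  rewrite ≡ᵇ-refl m = refl
cancels-flip (m , false) rewrite ≡ᵇ-refl m = refl

cancels-flip⇒≡ : (x y : Letter) → Cancels (flipL x) y ≡ true → y ≡ x
cancels-flip⇒≡ (m , s) (m' , s') c with m ≡ᵇ m' in eq
... | false = ⊥-elim (false≢true c)
  where
  false≢true : false ≢ true
  false≢true ()
... | true with ≡ᵇ⇒≡ m m' (subst T (sym eq) _)
...   | refl = cong (m ,_) (sign s s' c)
  where
  sign : (s s' : Bool) → not s xor s' ≡ true → s' ≡ s
  sign true  true  _ = refl
  sign false false _ = refl

distinct-noCancel : {m m' : ℕ} (s s' : Bool) → m ≢ m' → NoCancel (m , s) (m' , s')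
distinct-noCancel s s' m≢m' rewrite ≡ᵇ-distinct m≢m' = refl

push-keep : (x y : Letter) (w : List Letter) → NoCancel x y → push x (y ∷ w) ≡ x ∷ y ∷ w
push-keep (m , s) (m' , s') w nc with (m ≡ᵇ m') ∧ (s xor s')
push-keep _ _ w refl | false = refl

push-cancel : (x y : Letter) (w : List Letter) → Cancels x y ≡ true → push x (y ∷ w) ≡ w
push-cancel (m , s) (m' , s') w c with (m ≡ᵇ m') ∧ (s xor s')
push-cancel _ _ w refl | true = refl

-- Pushing a letter onto a reduced word gives a reduced word (splitting on the
-- cancellation test also unfolds the 'push' in the goal).
push-reduced : (x : Letter) {w : List Letter} → Reduced w → Reduced (push x w)
push-reduced x []                  = [-]
push-reduced x {y ∷ w} ry with Cancels x y in c
... | true  = tail ry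
... | false = c ∷ ry

reduce-reduced : (w : FG) → Reduced (reduce w)
reduce-reduced []      = []
reduce-reduced (x ∷ w) = push-reduced x (reduce-reduced w)

reduce-id : {w : FG} → Reduced w → reduce w ≡ w
reduce-id []                    = refl
reduce-id {x ∷ []} [-]          = refl
reduce-id {x ∷ y ∷ w} (nc ∷ rw) = trans (cong (push x) (reduce-id rw)) (push-keep x y w nc)

push-push-flip : (x : Letter) {r : List Letter} → Reduced r → push x (push (flipL x) r) ≡ r
push-push-flip x [] = push-cancel x (flipL x) [] (cancels-flip x)
push-push-flip x {y ∷ r} ry with Cancels (flipL x) y in c
... | false = push-cancel x (flipL x) (y ∷ r) (cancels-flip x)
... | true with cancels-flip⇒≡ x y c
...   | refl = restore ry
  where
  restore : Reduced (x ∷ r) → push x r ≡ x ∷ r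
  restore [-]       = refl
  restore (nc ∷ _)  = push-keep x _ _ nc

reduce-delete-pair : (v : FG) (x : Letter) (w : FG) →
  reduce (v ++ x ∷ flipL x ∷ w) ≡ reduce (v ++ w)
reduce-delete-pair v x w = begin
  reduce (v ++ x ∷ flipL x ∷ w)              ≡⟨ foldr-++ push [] v _ ⟩
  foldr push (reduce (x ∷ flipL x ∷ w)) v    ≡⟨ cong (λ r → foldr push r v)
                                                     (push-push-flip x (reduce-reduced w)) ⟩
  foldr push (reduce w) v                    ≡⟨ sym (foldr-++ push [] v w) ⟩
  reduce (v ++ w)                            ∎
  where open ≡-Reasoning

-- Generators with distinct indices do not commute in F_ω: their commutator
-- is a nonempty reduced word.
distinct-generators-noncommuting : {p q : ℕ} (s s' : Bool) → p ≢ q →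
  ¬ ([ gen (p , s) , gen (q , s') ] ≈ ε)
distinct-generators-noncommuting {p} {q} s s' p≢q trivial
  with trans (sym (reduce-id commutator-reduced)) trivial
  where
  q≢p : q ≢ p
  q≢p q≡p = p≢q (sym q≡p)
  commutator-reduced : Reduced ([ gen (p , s) , gen (q , s') ])
  commutator-reduced =
    distinct-noCancel (not s) (not s') p≢q ∷ distinct-noCancel (not s') s q≢p ∷
    distinct-noCancel s s' p≢q ∷ [-]
... | ()

lemma3p6 : (n i j k l : ℕ) →
    1 ≤ i → i ≤ n → 1 ≤ j → j ≤ n → 1 ≤ k → k ≤ n → 1 ≤ l → l ≤ n →
    i ≡ k → j ≢ l → ¬ φNE (a i j) (b k l)
lemma3p6 _ (suc i) j _ l _ _ _ _ _ _ _ _ refl j≢l φ =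
  φ u v (distinct-generators-noncommuting true false i+j≢i+l)
        (reduce-delete-pair (u ^ 5) (i , true) (v ^ 4))
  where
  u v : FG
  u = gen (i + j , true)
  v = gen (i + l , false)
  i+j≢i+l : i + j ≢ i + l
  i+j≢i+l eq = j≢l (+-cancelˡ-≡ i j l eq)
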